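{- Let $k\ge 2$, $n\in\mathbb{N}$ and $w\in S_n$. Then the number of inversions $I(k,n,w)$ of $\mathcal{C}_{k,n,w}$ is an integer multiple of $\frac{(k-1)^2k^n}{4}$, i.e. $\frac{4I(k,n,w)}{(k-1)^2k^n}\in\mathbb{Z}$.
   Context: The infinite rooted directed $k$-ary tree has a root on layer $1$; every vertex has $k$ children, ordered left to right, on the next layer. A vertex with at least $k$ chips may fire by choosing $k$ of its labeled chips and sending the $j$th smallest to its $j$th leftmost child. Chips $0,\dots,k^n-1$ start at the root and are written in $n$-digit $k$-ary expansion. For $w\in S_n$, the strategy $F_w$ fires, for each $i\in[n]$, each vertex $v$ on layer $i$ so that all chips on $v$ whose $w_i$th most significant digit equals $j$ go to the $(j+1)$th leftmost child of $v$. $\mathcal{C}_{k,n,w}$ is the resulting stable configuration, read as the sequence of chips on layer $n+1$ from left to right, and $I(k,n,w)$ is its number of inversions. -}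

module Defs where

open import Data.Nat using (ℕ; zero; suc; _+_; _*_; _∸_; _^_; _<?_; NonZero)
open import Data.Nat.Properties using (_≟_; m^n≢0)
open import Data.Nat.DivMod using (_/_; _%_)
open import Data.Fin using (Fin; toℕ)
open import Data.Fin.Permutation using (Permutation′; _⟨$⟩ʳ_)
open import Data.List using (List; []; _∷_; length; filter; concatMap; upTo; allFin; map)

-- The d-th most significant digit (d : Fin n, meaning digit number toℕ d + 1,
-- counted from the most significant end) of the n-digit base-k expansion of c.
digit : (k n : ℕ) .{{_ : NonZero k}} → Fin n → ℕ → ℕ
digit k n d c = (_/_ c (k ^ (n ∸ suc (toℕ d))) {{m^n≢0 k (n ∸ suc (toℕ d))}}) % k

-- Fire a vertex holding `chips` and all its descendants, where the remaining
-- layers use the digit positions `ds` (in order).  Returns the chips on the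
-- final layer below this vertex, read left to right.  Children are indexed
-- j = 0,…,k-1 from the left; chips with digit j go to child j.
fireBelow : (k n : ℕ) .{{_ : NonZero k}} → List (Fin n) → List ℕ → List ℕ
fireBelow k n [] chips = chips
fireBelow k n (d ∷ ds) chips =
  concatMap (λ j → fireBelow k n ds (filter (λ c → digit k n d c ≟ j) chips)) (upTo k)

-- The stable configuration C_{k,n,w}: chips 0,…,k^n-1 start at the root, and
-- layer i (i = 1,…,n) fires by the w_i-th most significant digit.
config : (k n : ℕ) .{{_ : NonZero k}} → Permutation′ n → List ℕ
config k n w = fireBelow k n (map (w ⟨$⟩ʳ_) (allFin n)) (upTo (k ^ n))

inversions : List ℕ → ℕ
inversions [] = 0
inversions (x ∷ xs) = length (filter (λ y → y <? x) xs) + inversions xs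

I : (k n : ℕ) .{{_ : NonZero k}} → Permutation′ n → ℕ
I k n w = inversions (config k n w)

{-# OPTIONS --safe #-}
-- Write each chip as its vector of k-ary digits and compare chips lexicographically.
-- If the first layer fires by digit d, the final configuration is the concatenation,
-- over j < k, of a configuration for the remaining n - 1 digits with j inserted at
-- position d. Inserting a fixed digit preserves lexicographic comparisons, so every
-- block has I' inversions, where (k-1)² k^(n-1) ∣ 4 I' by induction. The smaller
-- configuration is a permutation of all digit vectors, so the number c of inversions
-- between blocks i < j does not depend on i and j, and an explicit count shows
-- (k-1) k^(n-1) ∣ 2c. Summing over the k(k-1)/2 pairs of blocks,
-- 4 I = k · 4 I' + k (k-1) · 2c.
module Submission where

open import Defs
open import Data.Nat using (ℕ; _*_; _∸_; _^_; _≤_; NonZero)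
open import Data.Nat.Divisibility using (_∣_)
open import Data.Fin.Permutation using (Permutation′)

open import Data.Bool.Base using (Bool; true; false; if_then_else_; _∧_; _∨_)
open import Data.Fin.Base using (Fin; zero; suc; toℕ; punchOut)
open import Data.Fin.Properties using (punchIn-punchOut; toℕ<n) renaming (_≟_ to _≟ᶠ_)
open import Data.Fin.Permutation using (_⟨$⟩ʳ_)
open import Data.List.Base using (List; []; _∷_; _++_; map; concat; concatMap; filter; length; applyUpTo; upTo; allFin)
open import Data.List.Properties
  using (map-id; map-cong; map-cong-local; map-∘; ++-identityʳ; map-upTo; concatMap-map; concatMap-cong; map-concatMap;
         upTo-∷ʳ; length-map; length-upTo; filter-++; filter-all; filter-none)
open import Data.List.Relation.Unary.All as All using (All; []; _∷_)
open import Data.List.Relation.Unary.All.Properties using (map⁺; concat⁺; all-upTo; filter⁺)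
open import Data.List.Relation.Unary.AllPairs using (AllPairs; []; _∷_)
import Data.List.Relation.Unary.AllPairs.Properties as AllPairs
open import Data.Nat.Base using (zero; suc; _+_; _<_; z<s; s<s; s≤s)
open import Data.Nat.DivMod using (_/_; _%_; +-distrib-/-∣ˡ; m*n/n≡m; m<n⇒m/n≡0; m<n⇒m%n≡m; %-remove-+ˡ)
open import Data.Nat.Divisibility using (_∣0; n∣m*n; m∣m*n; *-monoʳ-∣; ∣m∣n⇒∣m+n)
open import Data.Nat.Properties
open import Algebra.Properties.CommutativeSemigroup +-commutativeSemigroup using (interchange)
open import Algebra.Properties.CommutativeSemigroup *-commutativeSemigroup using (x∙yz≈y∙xz)
open import Data.Nat.Tactic.RingSolver using (solve-∀)
open import Data.Vec.Base using (Vec; []; _∷_; lookup; insertAt)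
open import Data.Vec.Properties using (insertAt-lookup; insertAt-punchIn)
open import Data.Vec.Relation.Unary.All as VecAll using ([]; _∷_)
open import Data.Vec.Relation.Unary.All.Properties using (lookup⁺)
open import Function using (_∘_; flip; id)
open import Level using (Level)
open import Relation.Binary.Definitions using (tri<; tri≈; tri>)
open import Relation.Binary.PropositionalEquality
open import Relation.Nullary using (does; yes; no)
open import Relation.Nullary.Decidable using (dec-true; dec-false)
open import Relation.Unary using (Pred; Decidable)

private variable
  p : Level
  A B : Set
  P : Pred A p

-- Sums over lists

𝟙 : Bool → ℕ
𝟙 true = 1
𝟙 false = 0

∑ : (A → ℕ) → List A → ℕ
∑ g [] = 0
∑ g (x ∷ xs) = g x + ∑ g xs

∑-++ : ∀ (g : A → ℕ) xs ys → ∑ g (xs ++ ys) ≡ ∑ g xs + ∑ g ys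
∑-++ g [] ys = refl
∑-++ g (x ∷ xs) ys = trans (cong (g x +_) (∑-++ g xs ys)) (sym (+-assoc (g x) _ _))

∑-map : ∀ (g : B → ℕ) (f : A → B) xs → ∑ g (map f xs) ≡ ∑ (g ∘ f) xs
∑-map g f [] = refl
∑-map g f (x ∷ xs) = cong (g (f x) +_) (∑-map g f xs)

∑-concatMap : ∀ (g : B → ℕ) (f : A → List B) xs → ∑ g (concatMap f xs) ≡ ∑ (∑ g ∘ f) xs
∑-concatMap g f [] = refl
∑-concatMap g f (x ∷ xs) = trans (∑-++ g (f x) (concatMap f xs)) (cong (∑ g (f x) +_) (∑-concatMap g f xs))

∑-cong : {g h : A → ℕ} → (∀ x → g x ≡ h x) → ∀ xs → ∑ g xs ≡ ∑ h xs
∑-cong g≗h [] = refl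
∑-cong g≗h (x ∷ xs) = cong₂ _+_ (g≗h x) (∑-cong g≗h xs)

∑-cong-local : {g h : A → ℕ} {xs : List A} → All (λ x → g x ≡ h x) xs → ∑ g xs ≡ ∑ h xs
∑-cong-local [] = refl
∑-cong-local (gx≡hx ∷ eqs) = cong₂ _+_ gx≡hx (∑-cong-local eqs)

∑-+ : ∀ (g h : A → ℕ) xs → ∑ (λ x → g x + h x) xs ≡ ∑ g xs + ∑ h xs
∑-+ g h [] = refl
∑-+ g h (x ∷ xs) = trans (cong (g x + h x +_) (∑-+ g h xs)) (interchange (g x) (h x) (∑ g xs) (∑ h xs))

∑-*ʳ : ∀ (g : A → ℕ) c xs → ∑ (λ x → g x * c) xs ≡ ∑ g xs * c
∑-*ʳ g c [] = refl
∑-*ʳ g c (x ∷ xs) = trans (cong (g x * c +_) (∑-*ʳ g c xs)) (sym (*-distribʳ-+ c (g x) (∑ g xs)))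

∑-const : ∀ c (xs : List A) → ∑ (λ _ → c) xs ≡ length xs * c
∑-const c [] = refl
∑-const c (x ∷ xs) = cong (c +_) (∑-const c xs)

∑-zero : ∀ (xs : List A) → ∑ (λ _ → 0) xs ≡ 0
∑-zero xs = trans (∑-const 0 xs) (*-zeroʳ (length xs))

∑-swap : ∀ (f : A → B → ℕ) xs ys → ∑ (λ x → ∑ (f x) ys) xs ≡ ∑ (λ y → ∑ (flip f y) xs) ys
∑-swap f [] ys = sym (∑-zero ys)
∑-swap f (x ∷ xs) ys = trans (cong (∑ (f x) ys +_) (∑-swap f xs ys)) (sym (∑-+ (f x) _ ys))

∑-filter : ∀ (g : A → ℕ) (P? : Decidable P) xs →
  ∑ g (filter P? xs) ≡ ∑ (λ x → if does (P? x) then g x else 0) xs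
∑-filter g P? [] = refl
∑-filter g P? (x ∷ xs) with does (P? x)
... | true = cong (g x +_) (∑-filter g P? xs)
... | false = ∑-filter g P? xs

length-filter≡∑ : ∀ (P? : Decidable P) xs → length (filter P? xs) ≡ ∑ (𝟙 ∘ does ∘ P?) xs
length-filter≡∑ P? [] = refl
length-filter≡∑ P? (x ∷ xs) with does (P? x)
... | true = cong suc (length-filter≡∑ P? xs)
... | false = length-filter≡∑ P? xs

∑-upTo-suc : ∀ (g : ℕ → ℕ) n → ∑ g (upTo (suc n)) ≡ g 0 + ∑ (g ∘ suc) (upTo n)
∑-upTo-suc g n = cong (g 0 +_) (trans (cong (∑ g) (sym (map-upTo suc n))) (∑-map g suc (upTo n)))

∑-upTo-single : ∀ (g : ℕ → ℕ) {n j} → j < n → (∀ x → x ≢ j → g x ≡ 0) → ∑ g (upTo n) ≡ g j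
∑-upTo-single g {suc n} {zero} _ vanish = begin
  ∑ g (upTo (suc n))          ≡⟨ ∑-upTo-suc g n ⟩
  g 0 + ∑ (g ∘ suc) (upTo n)  ≡⟨ cong (g 0 +_) (∑-cong (λ x → vanish (suc x) λ ()) (upTo n)) ⟩
  g 0 + ∑ (λ _ → 0) (upTo n)  ≡⟨ cong (g 0 +_) (∑-zero (upTo n)) ⟩
  g 0 + 0                     ≡⟨ +-identityʳ (g 0) ⟩
  g 0                         ∎
  where open ≡-Reasoning
∑-upTo-single g {suc n} {suc j} (s<s j<n) vanish = begin
  ∑ g (upTo (suc n))          ≡⟨ ∑-upTo-suc g n ⟩
  g 0 + ∑ (g ∘ suc) (upTo n)  ≡⟨ cong (_+ ∑ (g ∘ suc) (upTo n)) (vanish 0 λ ()) ⟩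
  ∑ (g ∘ suc) (upTo n)        ≡⟨ ∑-upTo-single (g ∘ suc) j<n (λ x x≢j → vanish (suc x) (x≢j ∘ suc-injective)) ⟩
  g (suc j)                   ∎
  where open ≡-Reasoning

∑-upTo-compare : ∀ c e {n x} → x < n →
  ∑ (λ y → if does (y <? x) then c else if does (y ≟ x) then e else 0) (upTo n) ≡ x * c + e
∑-upTo-compare c e {suc n} {zero} _ = begin
  ∑ (λ y → if does (y <? 0) then c else if does (y ≟ 0) then e else 0) (upTo (suc n)) ≡⟨ ∑-upTo-suc _ n ⟩
  e + ∑ (λ _ → 0) (upTo n) ≡⟨ cong (e +_) (∑-zero (upTo n)) ⟩
  e + 0                    ≡⟨ +-identityʳ e ⟩
  e                        ∎
  where open ≡-Reasoning
∑-upTo-compare c e {suc n} {suc x} (s<s x<n) = begin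
  ∑ (λ y → if does (y <? suc x) then c else if does (y ≟ suc x) then e else 0) (upTo (suc n)) ≡⟨ ∑-upTo-suc _ n ⟩
  c + ∑ (λ y → if does (y <? x) then c else if does (y ≟ x) then e else 0) (upTo n) ≡⟨ cong (c +_) (∑-upTo-compare c e x<n) ⟩
  c + (x * c + e)         ≡⟨ +-assoc c (x * c) e ⟨
  suc x * c + e           ∎
  where open ≡-Reasoning

triangle : ℕ → ℕ
triangle zero = 0
triangle (suc n) = n + triangle n

2*triangle : ∀ n → 2 * triangle (suc n) ≡ suc n * n
2*triangle zero = refl
2*triangle (suc n) = begin
  2 * (suc n + triangle (suc n))   ≡⟨ *-distribˡ-+ 2 (suc n) (triangle (suc n)) ⟩
  2 * suc n + 2 * triangle (suc n) ≡⟨ cong (2 * suc n +_) (2*triangle n) ⟩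
  2 * suc n + suc n * n            ≡⟨ factor n ⟩
  suc (suc n) * suc n              ∎
  where
  open ≡-Reasoning
  factor : ∀ n → 2 * suc n + suc n * n ≡ suc (suc n) * suc n
  factor = solve-∀

∑-upTo-id : ∀ n → ∑ id (upTo n) ≡ triangle n
∑-upTo-id zero = refl
∑-upTo-id (suc n) = begin
  ∑ id (upTo (suc n))          ≡⟨ cong (∑ id) (upTo-∷ʳ n) ⟨
  ∑ id (upTo n ++ n ∷ [])      ≡⟨ ∑-++ id (upTo n) (n ∷ []) ⟩
  ∑ id (upTo n) + (n + 0)      ≡⟨ cong₂ _+_ (∑-upTo-id n) (+-identityʳ n) ⟩
  triangle n + n                      ≡⟨ +-comm (triangle n) n ⟩
  triangle (suc n)                    ∎
  where open ≡-Reasoning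

∑-upTo-affine : ∀ c e n → ∑ (λ x → x * c + e) (upTo n) ≡ triangle n * c + n * e
∑-upTo-affine c e n = begin
  ∑ (λ x → x * c + e) (upTo n)                 ≡⟨ ∑-+ (_* c) (λ _ → e) (upTo n) ⟩
  ∑ (_* c) (upTo n) + ∑ (λ _ → e) (upTo n)     ≡⟨ cong₂ _+_ (∑-*ʳ id c (upTo n)) (∑-const e (upTo n)) ⟩
  ∑ id (upTo n) * c + length (upTo n) * e ≡⟨ cong₂ (λ t l → t * c + l * e) (∑-upTo-id n) (length-upTo n) ⟩
  triangle n * c + n * e                       ∎
  where open ≡-Reasoning

concatMap-[] : ∀ (xs : List A) → concatMap {B = B} (λ _ → []) xs ≡ []
concatMap-[] [] = refl
concatMap-[] (_ ∷ xs) = concatMap-[] xs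

concatMap-upTo-suc : ∀ (f : ℕ → List A) n → concatMap f (upTo (suc n)) ≡ f 0 ++ concatMap (f ∘ suc) (upTo n)
concatMap-upTo-suc f n = cong (f 0 ++_) (trans (cong (concatMap f) (sym (map-upTo suc n))) (concatMap-map f suc (upTo n)))

concatMap-upTo-single : ∀ (f : ℕ → List A) {n j} → j < n → (∀ x → x ≢ j → f x ≡ []) → concatMap f (upTo n) ≡ f j
concatMap-upTo-single f {suc n} {zero} _ vanish = begin
  concatMap f (upTo (suc n))          ≡⟨ concatMap-upTo-suc f n ⟩
  f 0 ++ concatMap (f ∘ suc) (upTo n) ≡⟨ cong (f 0 ++_) (concatMap-cong (λ x → vanish (suc x) λ ()) (upTo n)) ⟩
  f 0 ++ concatMap (λ _ → []) (upTo n) ≡⟨ cong (f 0 ++_) (concatMap-[] (upTo n)) ⟩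
  f 0 ++ []                           ≡⟨ ++-identityʳ (f 0) ⟩
  f 0                                 ∎
  where open ≡-Reasoning
concatMap-upTo-single f {suc n} {suc j} (s<s j<n) vanish = begin
  concatMap f (upTo (suc n))          ≡⟨ concatMap-upTo-suc f n ⟩
  f 0 ++ concatMap (f ∘ suc) (upTo n) ≡⟨ cong (_++ concatMap (f ∘ suc) (upTo n)) (vanish 0 λ ()) ⟩
  concatMap (f ∘ suc) (upTo n)        ≡⟨ concatMap-upTo-single (f ∘ suc) j<n (λ x x≢j → vanish (suc x) (x≢j ∘ suc-injective)) ⟩
  f (suc j)                           ∎
  where open ≡-Reasoning

filter-map-local : ∀ {q} {Q : Pred B q} (Q? : Decidable Q) (P? : Decidable P) (f : A → B) {xs} →
  All (λ x → does (Q? (f x)) ≡ does (P? x)) xs → filter Q? (map f xs) ≡ map f (filter P? xs)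
filter-map-local Q? P? f [] = refl
filter-map-local Q? P? f {x ∷ xs} (eq ∷ eqs) with does (Q? (f x)) | does (P? x) | eq
... | true  | true  | refl = cong (f x ∷_) (filter-map-local Q? P? f eqs)
... | false | false | refl = filter-map-local Q? P? f eqs

filter-map : ∀ {q} {Q : Pred B q} (Q? : Decidable Q) (P? : Decidable P) (f : A → B) →
  (∀ x → does (Q? (f x)) ≡ does (P? x)) → ∀ xs → filter Q? (map f xs) ≡ map f (filter P? xs)
filter-map Q? P? f eq xs = filter-map-local Q? P? f (All.universal eq xs)

filter-concatMap : ∀ (P? : Decidable P) (f : A → List B) xs → filter P? (concatMap f xs) ≡ concatMap (filter P? ∘ f) xs
filter-concatMap P? f [] = refl
filter-concatMap P? f (x ∷ xs) = trans (filter-++ P? (f x) (concatMap f xs)) (cong (filter P? (f x) ++_) (filter-concatMap P? f xs))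

applyUpTo-+ : ∀ (f : ℕ → A) m n → applyUpTo f (m + n) ≡ applyUpTo f m ++ applyUpTo (λ x → f (m + x)) n
applyUpTo-+ f zero n = refl
applyUpTo-+ f (suc m) n = cong (f 0 ∷_) (applyUpTo-+ (f ∘ suc) m n)

upTo-* : ∀ n m → upTo (n * m) ≡ concatMap (λ x → map (x * m +_) (upTo m)) (upTo n)
upTo-* zero m = refl
upTo-* (suc n) m = begin
  upTo (m + n * m)                                              ≡⟨ applyUpTo-+ id m (n * m) ⟩
  upTo m ++ applyUpTo (m +_) (n * m)                            ≡⟨ cong (upTo m ++_) (map-upTo (m +_) (n * m)) ⟨
  upTo m ++ map (m +_) (upTo (n * m))                           ≡⟨ cong (λ l → upTo m ++ map (m +_) l) (upTo-* n m) ⟩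
  upTo m ++ map (m +_) (concatMap block (upTo n))               ≡⟨ cong (upTo m ++_) (map-concatMap (m +_) block (upTo n)) ⟩
  upTo m ++ concatMap (map (m +_) ∘ block) (upTo n)             ≡⟨ cong₂ _++_ (map-id (upTo m)) (concatMap-cong shift (upTo n)) ⟨
  block 0 ++ concatMap (block ∘ suc) (upTo n)                   ≡⟨ concatMap-upTo-suc block n ⟨
  concatMap block (upTo (suc n))                                ∎
  where
  open ≡-Reasoning
  block : ℕ → List ℕ
  block x = map (x * m +_) (upTo m)
  shift : ∀ x → block (suc x) ≡ map (m +_) (block x)
  shift x = trans (map-cong (+-assoc m (x * m)) (upTo m)) (map-∘ (upTo m))

-- Inversions

countPairs : (A → B → Bool) → List A → List B → ℕ
countPairs r xs ys = ∑ (λ x → ∑ (λ y → 𝟙 (r x y)) ys) xs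

countPairs-map : ∀ {C D : Set} (r : A → B → Bool) (f : C → A) (g : D → B) xs ys →
  countPairs r (map f xs) (map g ys) ≡ countPairs (λ x y → r (f x) (g y)) xs ys
countPairs-map r f g xs ys = trans (∑-map _ f xs) (∑-cong (λ x → ∑-map _ g ys) xs)

countPairs-concatMap : ∀ {C D : Set} (r : A → B → Bool) (f : C → List A) (g : D → List B) xs ys →
  countPairs r (concatMap f xs) (concatMap g ys) ≡ ∑ (λ x → ∑ (λ y → countPairs r (f x) (g y)) ys) xs
countPairs-concatMap r f g xs ys = begin
  countPairs r (concatMap f xs) (concatMap g ys)
    ≡⟨ ∑-concatMap _ f xs ⟩
  ∑ (λ x → ∑ (λ a → ∑ (λ b → 𝟙 (r a b)) (concatMap g ys)) (f x)) xs
    ≡⟨ ∑-cong (λ x → ∑-cong (λ a → ∑-concatMap _ g ys) (f x)) xs ⟩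
  ∑ (λ x → ∑ (λ a → ∑ (λ y → ∑ (λ b → 𝟙 (r a b)) (g y)) ys) (f x)) xs
    ≡⟨ ∑-cong (λ x → ∑-swap (λ a y → ∑ (λ b → 𝟙 (r a b)) (g y)) (f x) ys) xs ⟩
  ∑ (λ x → ∑ (λ y → countPairs r (f x) (g y)) ys) xs
    ∎
  where open ≡-Reasoning

countPairs-∨∧ : ∀ b c (r : A → B → Bool) xs ys →
  countPairs (λ x y → b ∨ (c ∧ r x y)) xs ys ≡ (if b then length xs * length ys else if c then countPairs r xs ys else 0)
countPairs-∨∧ true c r xs ys = trans (∑-cong (λ _ → trans (∑-const 1 ys) (*-identityʳ _)) xs) (∑-const (length ys) xs)
countPairs-∨∧ false true r xs ys = refl
countPairs-∨∧ false false r xs ys = trans (∑-cong (λ _ → ∑-zero ys) xs) (∑-zero xs)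

SameSums : List A → List A → Set
SameSums xs ys = ∀ g → ∑ g xs ≡ ∑ g ys

countPairs-SameSums : ∀ (r : A → B → Bool) {xs xs′ ys ys′} → SameSums xs xs′ → SameSums ys ys′ →
  countPairs r xs ys ≡ countPairs r xs′ ys′
countPairs-SameSums r {xs} xs≈xs′ ys≈ys′ = trans (∑-cong (λ x → ys≈ys′ _) xs) (xs≈xs′ _)

inversionsBy : (A → A → Bool) → List A → ℕ
inversionsBy lt [] = 0
inversionsBy lt (x ∷ xs) = ∑ (λ y → 𝟙 (lt y x)) xs + inversionsBy lt xs

inversions≡inversionsBy : ∀ xs → inversions xs ≡ inversionsBy (λ x y → does (x <? y)) xs
inversions≡inversionsBy [] = refl
inversions≡inversionsBy (x ∷ xs) = cong₂ _+_ (length-filter≡∑ (_<? x) xs) (inversions≡inversionsBy xs)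

inversionsBy-map : ∀ (lt : B → B → Bool) (f : A → B) xs →
  inversionsBy lt (map f xs) ≡ inversionsBy (λ x y → lt (f x) (f y)) xs
inversionsBy-map lt f [] = refl
inversionsBy-map lt f (x ∷ xs) = cong₂ _+_ (∑-map _ f xs) (inversionsBy-map lt f xs)

inversionsBy-cong : ∀ {lt lt′ : A → A → Bool} → (∀ x y → lt x y ≡ lt′ x y) → ∀ xs → inversionsBy lt xs ≡ inversionsBy lt′ xs
inversionsBy-cong lt≡lt′ [] = refl
inversionsBy-cong lt≡lt′ (x ∷ xs) = cong₂ _+_ (∑-cong (λ y → cong 𝟙 (lt≡lt′ y x)) xs) (inversionsBy-cong lt≡lt′ xs)

inversionsBy-cong-local : ∀ {lt lt′ : A → A → Bool} {xs} → All P xs →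
  (∀ {x y} → P x → P y → lt x y ≡ lt′ x y) → inversionsBy lt xs ≡ inversionsBy lt′ xs
inversionsBy-cong-local [] _ = refl
inversionsBy-cong-local (px ∷ pxs) lt≡lt′ =
  cong₂ _+_ (∑-cong-local (All.map (λ py → cong 𝟙 (lt≡lt′ py px)) pxs)) (inversionsBy-cong-local pxs lt≡lt′)

inversionsBy-++ : ∀ (lt : A → A → Bool) xs ys →
  inversionsBy lt (xs ++ ys) ≡ inversionsBy lt xs + inversionsBy lt ys + countPairs (flip lt) xs ys
inversionsBy-++ lt [] ys = sym (+-identityʳ _)
inversionsBy-++ lt (x ∷ xs) ys = begin
  ∑ (λ y → 𝟙 (lt y x)) (xs ++ ys) + inversionsBy lt (xs ++ ys)
    ≡⟨ cong₂ _+_ (∑-++ _ xs ys) (inversionsBy-++ lt xs ys) ⟩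
  (a + b) + (i + j + c)
    ≡⟨ rearrange a b i j c ⟩
  (a + i) + j + (b + c)
    ∎
  where
  open ≡-Reasoning
  a = ∑ (λ y → 𝟙 (lt y x)) xs
  b = ∑ (λ y → 𝟙 (lt y x)) ys
  i = inversionsBy lt xs
  j = inversionsBy lt ys
  c = countPairs (flip lt) xs ys
  rearrange : ∀ a b i j c → (a + b) + (i + j + c) ≡ (a + i) + j + (b + c)
  rearrange = solve-∀

inversionsBy-concatMap-uniform : ∀ (lt : A → A → Bool) (block : ℕ → List A) {c h} →
  (∀ j → inversionsBy lt (block j) ≡ c) →
  (∀ {i j} → i < j → countPairs (flip lt) (block i) (block j) ≡ h) →
  ∀ {js} → AllPairs _<_ js → inversionsBy lt (concatMap block js) ≡ length js * c + triangle (length js) * h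
inversionsBy-concatMap-uniform lt block inv≡c cross≡h [] = refl
inversionsBy-concatMap-uniform lt block {c} {h} inv≡c cross≡h {j ∷ js} (j<js ∷ sorted) = begin
  inversionsBy lt (block j ++ concatMap block js)
    ≡⟨ inversionsBy-++ lt (block j) (concatMap block js) ⟩
  inversionsBy lt (block j) + inversionsBy lt (concatMap block js) + countPairs (flip lt) (block j) (concatMap block js)
    ≡⟨ cong₂ (λ u v → u + v + countPairs (flip lt) (block j) (concatMap block js))
             (inv≡c j) (inversionsBy-concatMap-uniform lt block inv≡c cross≡h sorted) ⟩
  c + (l * c + triangle l * h) + countPairs (flip lt) (block j) (concatMap block js)
    ≡⟨ cong (c + (l * c + triangle l * h) +_) cross ⟩
  c + (l * c + triangle l * h) + l * h
    ≡⟨ rearrange c h l (triangle l) ⟩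
  suc l * c + (l + triangle l) * h
    ∎
  where
  open ≡-Reasoning
  l = length js
  cross : countPairs (flip lt) (block j) (concatMap block js) ≡ l * h
  cross = begin
    countPairs (flip lt) (block j) (concatMap block js)   ≡⟨ ∑-cong (λ x → ∑-concatMap _ block js) (block j) ⟩
    ∑ (λ x → ∑ (λ j′ → ∑ (λ y → 𝟙 (lt y x)) (block j′)) js) (block j) ≡⟨ ∑-swap _ (block j) js ⟩
    ∑ (λ j′ → countPairs (flip lt) (block j) (block j′)) js ≡⟨ ∑-cong-local (All.map cross≡h j<js) ⟩
    ∑ (λ _ → h) js                                        ≡⟨ ∑-const h js ⟩
    l * h                                                 ∎
  rearrange : ∀ c h l t → c + (l * c + t * h) + l * h ≡ suc l * c + (l + t) * h
  rearrange = solve-∀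

-- Place value and divisibility

[m*n+o]/n≡m : ∀ m {n o} .{{_ : NonZero n}} → o < n → (m * n + o) / n ≡ m
[m*n+o]/n≡m m {n} {o} o<n = begin
  (m * n + o) / n     ≡⟨ +-distrib-/-∣ˡ o (n∣m*n m) ⟩
  m * n / n + o / n   ≡⟨ cong₂ _+_ (m*n/n≡m m n) (m<n⇒m/n≡0 o<n) ⟩
  m + 0               ≡⟨ +-identityʳ m ⟩
  m                   ∎
  where open ≡-Reasoning

[m*k*n+o]/n%k≡o/n%k : ∀ m k {n} o .{{_ : NonZero k}} .{{_ : NonZero n}} → (m * k * n + o) / n % k ≡ o / n % k
[m*k*n+o]/n%k≡o/n%k m k {n} o = begin
  (m * k * n + o) / n % k     ≡⟨ cong (_% k) (+-distrib-/-∣ˡ o (n∣m*n (m * k))) ⟩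
  (m * k * n / n + o / n) % k ≡⟨ cong (λ x → (x + o / n) % k) (m*n/n≡m (m * k) n) ⟩
  (m * k + o / n) % k         ≡⟨ %-remove-+ˡ (o / n) (n∣m*n m) ⟩
  o / n % k                   ∎
  where open ≡-Reasoning

+-cancelˡ-<? : ∀ c a b → does (c + a <? c + b) ≡ does (a <? b)
+-cancelˡ-<? zero a b = refl
+-cancelˡ-<? (suc c) a b = +-cancelˡ-<? c a b

place-value-< : ∀ {x y K a} b → x < y → a < K → x * K + a < y * K + b
place-value-< {x} {y} {K} {a} b x<y a<K = begin-strict
  x * K + a   <⟨ +-monoʳ-< (x * K) a<K ⟩
  x * K + K   ≡⟨ +-comm (x * K) K ⟩
  suc x * K   ≤⟨ *-monoˡ-≤ K x<y ⟩
  y * K       ≤⟨ m≤m+n (y * K) b ⟩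
  y * K + b   ∎
  where open ≤-Reasoning

place-value-<? : ∀ x y {K a b} → a < K → b < K →
  does (x * K + a <? y * K + b) ≡ does (x <? y) ∨ (does (x ≟ y) ∧ does (a <? b))
place-value-<? x y {K} {a} {b} a<K b<K with <-cmp x y
... | tri< x<y _ _ rewrite dec-true (x <? y) x<y = dec-true (_ <? _) (place-value-< b x<y a<K)
... | tri≈ _ refl _ rewrite dec-false (x <? x) (n≮n x) | dec-true (x ≟ x) refl = +-cancelˡ-<? (x * K) a b
... | tri> _ x≢y y<x rewrite dec-false (x <? y) (<⇒≯ y<x) | dec-false (x ≟ y) x≢y =
  dec-false (_ <? _) (<⇒≯ (place-value-< a y<x b<K))

block-sum-divisible : ∀ {k′ K i c} → k′ ^ 2 * K ∣ 4 * i → k′ * K ∣ 2 * c →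
  k′ ^ 2 * (suc k′ * K) ∣ 4 * (suc k′ * i + triangle (suc k′) * c)
block-sum-divisible {k′} {K} {i} {c} k′²K∣4i k′K∣2c =
  subst₂ _∣_ (x∙yz≈y∙xz (suc k′) (k′ ^ 2) K) (sym sum≡)
    (*-monoʳ-∣ (suc k′) (∣m∣n⇒∣m+n k′²K∣4i (subst (_∣ k′ * (2 * c)) square (*-monoʳ-∣ k′ k′K∣2c))))
  where
  open ≡-Reasoning
  square : k′ * (k′ * K) ≡ k′ ^ 2 * K
  square = trans (sym (*-assoc k′ k′ K)) (cong (λ x → k′ * x * K) (sym (*-identityʳ k′)))
  regroup : ∀ k i t c → 4 * (k * i + t * c) ≡ k * (4 * i) + 2 * t * (2 * c)
  regroup = solve-∀
  regroup′ : ∀ k l i c → k * (4 * i) + k * l * (2 * c) ≡ k * (4 * i + l * (2 * c))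
  regroup′ = solve-∀
  sum≡ : 4 * (suc k′ * i + triangle (suc k′) * c) ≡ suc k′ * (4 * i + k′ * (2 * c))
  sum≡ = begin
    4 * (suc k′ * i + triangle (suc k′) * c)           ≡⟨ regroup (suc k′) i (triangle (suc k′)) c ⟩
    suc k′ * (4 * i) + 2 * triangle (suc k′) * (2 * c) ≡⟨ cong (λ t → suc k′ * (4 * i) + t * (2 * c)) (2*triangle k′) ⟩
    suc k′ * (4 * i) + suc k′ * k′ * (2 * c)           ≡⟨ regroup′ (suc k′) k′ i c ⟩
    suc k′ * (4 * i + k′ * (2 * c))                    ∎

cross-step-divisible : ∀ {k′ K c} → k′ * K ∣ 2 * c →
  k′ * (suc k′ * K) ∣ 2 * (triangle (suc k′) * (K * K) + suc k′ * c)
cross-step-divisible {k′} {K} {c} k′K∣2c =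
  subst₂ _∣_ (x∙yz≈y∙xz (suc k′) k′ K) (sym sum≡) (*-monoʳ-∣ (suc k′) (∣m∣n⇒∣m+n (m∣m*n K) k′K∣2c))
  where
  open ≡-Reasoning
  regroup : ∀ k t K c → 2 * (t * (K * K) + k * c) ≡ 2 * t * (K * K) + k * (2 * c)
  regroup = solve-∀
  regroup′ : ∀ k l K c → k * l * (K * K) + k * (2 * c) ≡ k * (l * K * K + 2 * c)
  regroup′ = solve-∀
  sum≡ : 2 * (triangle (suc k′) * (K * K) + suc k′ * c) ≡ suc k′ * (k′ * K * K + 2 * c)
  sum≡ = begin
    2 * (triangle (suc k′) * (K * K) + suc k′ * c)        ≡⟨ regroup (suc k′) (triangle (suc k′)) K c ⟩
    2 * triangle (suc k′) * (K * K) + suc k′ * (2 * c)    ≡⟨ cong (λ t → t * (K * K) + suc k′ * (2 * c)) (2*triangle k′) ⟩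
    suc k′ * k′ * (K * K) + suc k′ * (2 * c)              ≡⟨ regroup′ (suc k′) k′ K c ⟩
    suc k′ * (k′ * K * K + 2 * c)                         ∎

-- Digit vectors

module Radix (k′ : ℕ) where

  k : ℕ
  k = suc k′

  Bounded : ∀ {n} → Vec ℕ n → Set
  Bounded = VecAll.All (_< k)

  digits : (n : ℕ) → List (Vec ℕ n)
  digits zero = [] ∷ []
  digits (suc n) = concatMap (λ x → map (x ∷_) (digits n)) (upTo k)

  value : ∀ {n} → Vec ℕ n → ℕ
  value [] = 0
  value {suc n} (x ∷ v) = x * k ^ n + value v

  lex : ∀ {n} → Vec ℕ n → Vec ℕ n → Bool
  lex [] [] = false
  lex (x ∷ u) (y ∷ v) = does (x <? y) ∨ (does (x ≟ y) ∧ lex u v)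

  fireVectors : ∀ {n} → List (Fin n) → List (Vec ℕ n) → List (Vec ℕ n)
  fireVectors [] vs = vs
  fireVectors (d ∷ ds) vs = concatMap (λ j → fireVectors ds (filter (λ v → lookup v d ≟ j) vs)) (upTo k)

  digits-bounded : ∀ n → All Bounded (digits n)
  digits-bounded zero = [] ∷ []
  digits-bounded (suc n) = concat⁺ (map⁺ (All.map (λ x<k → map⁺ (All.map (x<k ∷_) (digits-bounded n))) (all-upTo k)))

  All-fireVectors : ∀ {n p} {P : Vec ℕ n → Set p} ds {vs} → All P vs → All P (fireVectors ds vs)
  All-fireVectors [] pvs = pvs
  All-fireVectors (d ∷ ds) pvs = concat⁺ (map⁺ (All.universal (λ j → All-fireVectors ds (filter⁺ _ pvs)) (upTo k)))

  value-< : ∀ {n} {v : Vec ℕ n} → Bounded v → value v < k ^ n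
  value-< [] = z<s
  value-< {suc n} {x ∷ v} (x<k ∷ bv) = subst (x * k ^ n + value v <_) (+-identityʳ (k ^ suc n)) (place-value-< 0 x<k (value-< bv))

  value-<? : ∀ {n} {u v : Vec ℕ n} → Bounded u → Bounded v → does (value u <? value v) ≡ lex u v
  value-<? [] [] = refl
  value-<? {u = x ∷ u} {y ∷ v} (_ ∷ bu) (_ ∷ bv) =
    trans (place-value-<? x y (value-< bu) (value-< bv)) (cong (λ b → does (x <? y) ∨ (does (x ≟ y) ∧ b)) (value-<? bu bv))

  digit-value : ∀ {n} {v : Vec ℕ n} → Bounded v → ∀ d → digit k n d (value v) ≡ lookup v d
  digit-value {suc m} {x ∷ v} (x<k ∷ bv) zero =
    trans (cong (_% k) ([m*n+o]/n≡m x {{m^n≢0 k m}} (value-< bv))) (m<n⇒m%n≡m x<k)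
  digit-value {suc m} {x ∷ v} (x<k ∷ bv) (suc d) = begin
    _/_ (x * k ^ m + value v) K {{m^n≢0 k e}} % k               ≡⟨ cong (λ a → _/_ (a + value v) K {{m^n≢0 k e}} % k) split ⟩
    _/_ (x * k ^ i * k * K + value v) K {{m^n≢0 k e}} % k       ≡⟨ [m*k*n+o]/n%k≡o/n%k (x * k ^ i) k (value v) {{_}} {{m^n≢0 k e}} ⟩
    digit k m d (value v)                                       ≡⟨ digit-value bv d ⟩
    lookup v d                                                  ∎
    where
    open ≡-Reasoning
    i = toℕ d
    e = m ∸ suc i
    K = k ^ e
    regroup : ∀ x k a b → x * (k * a * b) ≡ x * a * k * b
    regroup = solve-∀
    split : x * k ^ m ≡ x * k ^ i * k * K
    split = begin
      x * k ^ m             ≡⟨ cong (λ a → x * k ^ a) (m+[n∸m]≡n (toℕ<n d)) ⟨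
      x * k ^ (suc i + e)   ≡⟨ cong (x *_) (^-distribˡ-+-* k (suc i) e) ⟩
      x * (k * k ^ i * K)   ≡⟨ regroup x k (k ^ i) K ⟩
      x * k ^ i * k * K     ∎

  map-value-digits : ∀ n → map value (digits n) ≡ upTo (k ^ n)
  map-value-digits zero = refl
  map-value-digits (suc n) = begin
    map value (concatMap (λ x → map (x ∷_) (digits n)) (upTo k))   ≡⟨ map-concatMap value _ (upTo k) ⟩
    concatMap (λ x → map value (map (x ∷_) (digits n))) (upTo k)   ≡⟨ concatMap-cong (λ x → trans (sym (map-∘ (digits n))) (map-∘ (digits n))) (upTo k) ⟩
    concatMap (λ x → map (x * K +_) (map value (digits n))) (upTo k) ≡⟨ concatMap-cong (λ x → cong (map (x * K +_)) (map-value-digits n)) (upTo k) ⟩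
    concatMap (λ x → map (x * K +_) (upTo K)) (upTo k)             ≡⟨ upTo-* k K ⟨
    upTo (k * K)                                                   ∎
    where
    open ≡-Reasoning
    K = k ^ n

  length-digits : ∀ n → length (digits n) ≡ k ^ n
  length-digits n = begin
    length (digits n)             ≡⟨ length-map value (digits n) ⟨
    length (map value (digits n)) ≡⟨ cong length (map-value-digits n) ⟩
    length (upTo (k ^ n))         ≡⟨ length-upTo (k ^ n) ⟩
    k ^ n                         ∎
    where open ≡-Reasoning

  fireBelow-map-value : ∀ {n} ds {vs : List (Vec ℕ n)} → All Bounded vs →
    fireBelow k n ds (map value vs) ≡ map value (fireVectors ds vs)
  fireBelow-map-value [] _ = refl
  fireBelow-map-value {n} (d ∷ ds) {vs} bvs = begin
    concatMap (λ j → fireBelow k n ds (filter (λ c → digit k n d c ≟ j) (map value vs))) (upTo k)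
      ≡⟨ concatMap-cong (λ j → cong (fireBelow k n ds) (filter-map-local _ _ value (All.map (digit-≟ j) bvs))) (upTo k) ⟩
    concatMap (λ j → fireBelow k n ds (map value (filter (λ v → lookup v d ≟ j) vs))) (upTo k)
      ≡⟨ concatMap-cong (λ j → fireBelow-map-value ds (filter⁺ _ bvs)) (upTo k) ⟩
    concatMap (λ j → map value (fireVectors ds (filter (λ v → lookup v d ≟ j) vs))) (upTo k)
      ≡⟨ map-concatMap value _ (upTo k) ⟨
    map value (fireVectors (d ∷ ds) vs)
      ∎
    where
    open ≡-Reasoning
    digit-≟ : ∀ j {v} → Bounded v → does (digit k n d (value v) ≟ j) ≡ does (lookup v d ≟ j)
    digit-≟ j bv = cong (λ x → does (x ≟ j)) (digit-value bv d)

  I≡inversionsBy-lex : ∀ n (w : Permutation′ n) →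
    I k n w ≡ inversionsBy lex (fireVectors (map (w ⟨$⟩ʳ_) (allFin n)) (digits n))
  I≡inversionsBy-lex n w = begin
    inversions (fireBelow k n ds (upTo (k ^ n)))            ≡⟨ cong (inversions ∘ fireBelow k n ds) (map-value-digits n) ⟨
    inversions (fireBelow k n ds (map value (digits n)))    ≡⟨ cong inversions (fireBelow-map-value ds (digits-bounded n)) ⟩
    inversions (map value leaves)                           ≡⟨ inversions≡inversionsBy (map value leaves) ⟩
    inversionsBy (λ x y → does (x <? y)) (map value leaves) ≡⟨ inversionsBy-map _ value leaves ⟩
    inversionsBy (λ u v → does (value u <? value v)) leaves ≡⟨ inversionsBy-cong-local (All-fireVectors ds (digits-bounded n)) value-<? ⟩
    inversionsBy lex leaves                                 ∎
    where
    open ≡-Reasoning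
    ds = map (w ⟨$⟩ʳ_) (allFin n)
    leaves = fireVectors ds (digits n)

  insert : ∀ {m} → Fin (suc m) → ℕ → Vec ℕ m → Vec ℕ (suc m)
  insert d j v = insertAt v d j

  filter-digits : ∀ {m} (d : Fin (suc m)) {j} → j < k →
    filter (λ v → lookup v d ≟ j) (digits (suc m)) ≡ map (insert d j) (digits m)
  filter-digits {m} zero {j} j<k = begin
    filter P? (concatMap F (upTo k))   ≡⟨ filter-concatMap P? F (upTo k) ⟩
    concatMap (filter P? ∘ F) (upTo k) ≡⟨ concatMap-upTo-single (filter P? ∘ F) j<k emptied ⟩
    filter P? (F j)                    ≡⟨ filter-all P? (map⁺ {f = j ∷_} (All.universal (λ _ → refl) (digits m))) ⟩
    F j                                ∎
    where
    open ≡-Reasoning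
    P? = λ (v : Vec ℕ (suc m)) → lookup v zero ≟ j
    F = λ x → map (x ∷_) (digits m)
    emptied : ∀ x → x ≢ j → filter P? (F x) ≡ []
    emptied x x≢j = filter-none P? (map⁺ {f = x ∷_} (All.universal (λ _ → x≢j) (digits m)))
  filter-digits {suc m} (suc d) {j} j<k = begin
    filter P? (concatMap F (upTo k))                             ≡⟨ filter-concatMap P? F (upTo k) ⟩
    concatMap (filter P? ∘ F) (upTo k)                           ≡⟨ concatMap-cong shift (upTo k) ⟩
    concatMap (map (insert (suc d) j) ∘ G) (upTo k)              ≡⟨ map-concatMap (insert (suc d) j) G (upTo k) ⟨
    map (insert (suc d) j) (concatMap G (upTo k))                ∎
    where
    open ≡-Reasoning
    P? = λ (v : Vec ℕ (suc (suc m))) → lookup v (suc d) ≟ j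
    F = λ x → map (x ∷_) (digits (suc m))
    G = λ x → map (x ∷_) (digits m)
    shift : ∀ x → filter P? (F x) ≡ map (insert (suc d) j) (G x)
    shift x = begin
      filter P? (map (x ∷_) (digits (suc m)))                    ≡⟨ filter-map P? (λ v → lookup v d ≟ j) (x ∷_) (λ _ → refl) (digits (suc m)) ⟩
      map (x ∷_) (filter (λ v → lookup v d ≟ j) (digits (suc m))) ≡⟨ cong (map (x ∷_)) (filter-digits d j<k) ⟩
      map (x ∷_) (map (insert d j) (digits m))                   ≡⟨ map-∘ (digits m) ⟨
      map (λ v → x ∷ insert d j v) (digits m)                    ≡⟨ map-∘ (digits m) ⟩
      map (insert (suc d) j) (G x)                               ∎

  fireVectors-[] : ∀ {n} (ds : List (Fin n)) → fireVectors ds [] ≡ []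
  fireVectors-[] [] = refl
  fireVectors-[] (d ∷ ds) = trans (concatMap-cong (λ _ → fireVectors-[] ds) (upTo k)) (concatMap-[] (upTo k))

  lookup-insert-≢ : ∀ {m} {d e : Fin (suc m)} (d≢e : d ≢ e) j (v : Vec ℕ m) →
    lookup (insert d j v) e ≡ lookup v (punchOut d≢e)
  lookup-insert-≢ {d = d} d≢e j v =
    trans (cong (lookup (insert d j v)) (sym (punchIn-punchOut d≢e))) (insertAt-punchIn v d j (punchOut d≢e))

  -- Occurrences of d are dropped: once digit d is fixed, firing by it sends all vectors to one child.
  punchOutAll : ∀ {m} → Fin (suc m) → List (Fin (suc m)) → List (Fin m)
  punchOutAll d [] = []
  punchOutAll d (e ∷ es) with d ≟ᶠ e
  ... | yes _ = punchOutAll d es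
  ... | no d≢e = punchOut d≢e ∷ punchOutAll d es

  fireVectors-map-insert : ∀ {m} (d : Fin (suc m)) {j} → j < k → ∀ ds vs →
    fireVectors ds (map (insert d j) vs) ≡ map (insert d j) (fireVectors (punchOutAll d ds) vs)
  fireVectors-map-insert d j<k [] vs = refl
  fireVectors-map-insert d {j} j<k (e ∷ es) vs with d ≟ᶠ e
  ... | yes refl = begin
    concatMap (λ j′ → fireVectors es (filter (P? j′) (map (insert d j) vs))) (upTo k)
      ≡⟨ concatMap-upTo-single _ j<k emptied ⟩
    fireVectors es (filter (P? j) (map (insert d j) vs))
      ≡⟨ cong (fireVectors es) (filter-all (P? j) inserted) ⟩
    fireVectors es (map (insert d j) vs)
      ≡⟨ fireVectors-map-insert d j<k es vs ⟩
    map (insert d j) (fireVectors (punchOutAll d es) vs)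
      ∎
    where
    open ≡-Reasoning
    P? = λ j′ v → lookup v d ≟ j′
    inserted : All (λ v → lookup v d ≡ j) (map (insert d j) vs)
    inserted = map⁺ (All.universal (λ v → insertAt-lookup v d j) vs)
    emptied : ∀ j′ → j′ ≢ j → fireVectors es (filter (P? j′) (map (insert d j) vs)) ≡ []
    emptied j′ j′≢j = begin
      fireVectors es (filter (P? j′) (map (insert d j) vs)) ≡⟨ cong (fireVectors es) (filter-none (P? j′) (All.map (λ v≡j v≡j′ → j′≢j (trans (sym v≡j′) v≡j)) inserted)) ⟩
      fireVectors es []                                    ≡⟨ fireVectors-[] es ⟩
      []                                                   ∎
  ... | no d≢e = begin
    concatMap (λ j′ → fireVectors es (filter (λ v → lookup v e ≟ j′) (map (insert d j) vs))) (upTo k)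
      ≡⟨ concatMap-cong (λ j′ → cong (fireVectors es) (filter-map _ _ (insert d j) (lookup-≟ j′) vs)) (upTo k) ⟩
    concatMap (λ j′ → fireVectors es (map (insert d j) (filter (λ v → lookup v e′ ≟ j′) vs))) (upTo k)
      ≡⟨ concatMap-cong (λ j′ → fireVectors-map-insert d j<k es _) (upTo k) ⟩
    concatMap (λ j′ → map (insert d j) (fireVectors (punchOutAll d es) (filter (λ v → lookup v e′ ≟ j′) vs))) (upTo k)
      ≡⟨ map-concatMap (insert d j) _ (upTo k) ⟨
    map (insert d j) (fireVectors (e′ ∷ punchOutAll d es) vs)
      ∎
    where
    open ≡-Reasoning
    e′ = punchOut d≢e
    lookup-≟ : ∀ j′ v → does (lookup (insert d j v) e ≟ j′) ≡ does (lookup v e′ ≟ j′)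
    lookup-≟ j′ v = cong (λ x → does (x ≟ j′)) (lookup-insert-≢ d≢e j v)

  fireVectors-digits : ∀ {m} (d : Fin (suc m)) ds →
    fireVectors (d ∷ ds) (digits (suc m)) ≡ concatMap (λ j → map (insert d j) (fireVectors (punchOutAll d ds) (digits m))) (upTo k)
  fireVectors-digits {m} d ds = cong concat (map-cong-local (All.map block (all-upTo k)))
    where
    block : ∀ {j} → j < k → fireVectors ds (filter (λ v → lookup v d ≟ j) (digits (suc m))) ≡ map (insert d j) (fireVectors (punchOutAll d ds) (digits m))
    block j<k = trans (cong (fireVectors ds) (filter-digits d j<k)) (fireVectors-map-insert d j<k ds (digits m))

  fireVectors-SameSums : ∀ {n} (ds : List (Fin n)) {vs} → All Bounded vs → SameSums (fireVectors ds vs) vs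
  fireVectors-SameSums [] _ g = refl
  fireVectors-SameSums (d ∷ ds) {vs} bvs g = begin
    ∑ g (concatMap (λ j → fireVectors ds (filter (P? j) vs)) (upTo k))  ≡⟨ ∑-concatMap g (λ j → fireVectors ds (filter (P? j) vs)) (upTo k) ⟩
    ∑ (λ j → ∑ g (fireVectors ds (filter (P? j) vs))) (upTo k)          ≡⟨ ∑-cong (λ j → fireVectors-SameSums ds (filter⁺ (P? j) bvs) g) (upTo k) ⟩
    ∑ (λ j → ∑ g (filter (P? j) vs)) (upTo k)                          ≡⟨ ∑-cong (λ j → ∑-filter g (P? j) vs) (upTo k) ⟩
    ∑ (λ j → ∑ (λ v → if does (P? j v) then g v else 0) vs) (upTo k)   ≡⟨ ∑-swap _ (upTo k) vs ⟩
    ∑ (λ v → ∑ (λ j → if does (P? j v) then g v else 0) (upTo k)) vs   ≡⟨ ∑-cong-local (All.map (λ {v} bv → pick v (lookup⁺ bv d)) bvs) ⟩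
    ∑ g vs                                                             ∎
    where
    open ≡-Reasoning
    P? = λ j v → lookup v d ≟ j
    pick : ∀ v → lookup v d < k → ∑ (λ j → if does (P? j v) then g v else 0) (upTo k) ≡ g v
    pick v vd<k = trans (∑-upTo-single _ vd<k (λ j j≢vd → cong (if_then g v else 0) (dec-false (P? j v) (j≢vd ∘ sym))))
                        (cong (if_then g v else 0) (dec-true (P? (lookup v d) v) refl))

  lex-insert : ∀ {m} (d : Fin (suc m)) j (u v : Vec ℕ m) → lex (insert d j u) (insert d j v) ≡ lex u v
  lex-insert zero j u v rewrite dec-false (j <? j) (n≮n j) | dec-true (j ≟ j) refl = refl
  lex-insert (suc d) j (x ∷ u) (y ∷ v) = cong (λ b → does (x <? y) ∨ (does (x ≟ y) ∧ b)) (lex-insert d j u v)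

  -- Split pairs by their first coordinates x, y: all K² pairs count if y < x, and if y = x they recurse.
  crossCount : (m : ℕ) → Fin (suc m) → ℕ
  crossCount m zero = 0
  crossCount (suc m) (suc d) = triangle k * (k ^ m * k ^ m) + k * crossCount m d

  countPairs-insert : ∀ m (d : Fin (suc m)) {i j} → i < j →
    countPairs (λ u v → lex (insert d j v) (insert d i u)) (digits m) (digits m) ≡ crossCount m d
  countPairs-insert m zero {i} {j} i<j rewrite dec-false (j <? i) (<⇒≯ i<j) | dec-false (j ≟ i) (>⇒≢ i<j) =
    countPairs-∨∧ false false (flip lex) (digits m) (digits m)
  countPairs-insert (suc m) (suc d) {i} {j} i<j = begin
    countPairs R (concatMap F U) (concatMap F U)                 ≡⟨ countPairs-concatMap R F F U U ⟩
    ∑ (λ x → ∑ (λ y → countPairs R (F x) (F y)) U) U            ≡⟨ ∑-cong (λ x → ∑-cong (block x) U) U ⟩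
    ∑ (λ x → ∑ (λ y → compare y x) U) U                         ≡⟨ ∑-cong-local (All.map (∑-upTo-compare (K * K) (crossCount m d)) (all-upTo k)) ⟩
    ∑ (λ x → x * (K * K) + crossCount m d) U                    ≡⟨ ∑-upTo-affine (K * K) (crossCount m d) k ⟩
    triangle k * (K * K) + k * crossCount m d                   ∎
    where
    open ≡-Reasoning
    U = upTo k
    K = k ^ m
    R = λ u v → lex (insert (suc d) j v) (insert (suc d) i u)
    F = λ x → map (x ∷_) (digits m)
    compare : ℕ → ℕ → ℕ
    compare y x = if does (y <? x) then K * K else if does (y ≟ x) then crossCount m d else 0
    block : ∀ x y → countPairs R (F x) (F y) ≡ compare y x
    block x y = begin
      countPairs R (F x) (F y)
        ≡⟨ countPairs-map R (x ∷_) (y ∷_) (digits m) (digits m) ⟩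
      countPairs (λ u v → does (y <? x) ∨ (does (y ≟ x) ∧ lex (insert d j v) (insert d i u))) (digits m) (digits m)
        ≡⟨ countPairs-∨∧ (does (y <? x)) (does (y ≟ x)) _ (digits m) (digits m) ⟩
      (if does (y <? x) then length (digits m) * length (digits m)
       else if does (y ≟ x) then countPairs (λ u v → lex (insert d j v) (insert d i u)) (digits m) (digits m) else 0)
        ≡⟨ cong₂ (λ a b → if does (y <? x) then a else if does (y ≟ x) then b else 0)
                 (cong₂ _*_ (length-digits m) (length-digits m)) (countPairs-insert m d i<j) ⟩
      compare y x
        ∎

  crossCount-divisible : ∀ m d → k′ * k ^ m ∣ 2 * crossCount m d
  crossCount-divisible m zero = _ ∣0
  crossCount-divisible (suc m) (suc d) = cross-step-divisible {k′} {k ^ m} {crossCount m d} (crossCount-divisible m d)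

  inversionsBy-insert-blocks : ∀ {m} (d : Fin (suc m)) ys → SameSums ys (digits m) →
    inversionsBy lex (concatMap (λ j → map (insert d j) ys) (upTo k)) ≡ k * inversionsBy lex ys + triangle k * crossCount m d
  inversionsBy-insert-blocks {m} d ys ys≈digits =
    trans (inversionsBy-concatMap-uniform lex (λ j → map (insert d j) ys) within across (AllPairs.applyUpTo⁺₁ id k (λ i<j _ → i<j)))
          (cong (λ l → l * inversionsBy lex ys + triangle l * crossCount m d) (length-upTo k))
    where
    within : ∀ j → inversionsBy lex (map (insert d j) ys) ≡ inversionsBy lex ys
    within j = trans (inversionsBy-map lex (insert d j) ys) (inversionsBy-cong (lex-insert d j) ys)
    across : ∀ {i j} → i < j → countPairs (flip lex) (map (insert d i) ys) (map (insert d j) ys) ≡ crossCount m d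
    across {i} {j} i<j = begin
      countPairs (flip lex) (map (insert d i) ys) (map (insert d j) ys) ≡⟨ countPairs-map (flip lex) _ _ ys ys ⟩
      countPairs R ys ys                                               ≡⟨ countPairs-SameSums R {ys} {digits m} {ys} {digits m} ys≈digits ys≈digits ⟩
      countPairs R (digits m) (digits m)                               ≡⟨ countPairs-insert m d i<j ⟩
      crossCount m d                                                   ∎
      where
      open ≡-Reasoning
      R = λ u v → lex (insert d j v) (insert d i u)

  Divisible : ∀ {m} → List (Vec ℕ m) → Set
  Divisible {m} vs = k′ ^ 2 * k ^ m ∣ 4 * inversionsBy lex vs

  insert-blocks-divisible : ∀ {m} (d : Fin (suc m)) ys → SameSums ys (digits m) → Divisible ys →
    Divisible (concatMap (λ j → map (insert d j) ys) (upTo k))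
  insert-blocks-divisible {m} d ys ys≈digits dvd =
    subst (λ x → k′ ^ 2 * k ^ suc m ∣ 4 * x) (sym (inversionsBy-insert-blocks d ys ys≈digits))
          (block-sum-divisible {k′} {k ^ m} {inversionsBy lex ys} {crossCount m d} dvd (crossCount-divisible m d))

  fireVectors-divisible : ∀ m (ds : List (Fin m)) → Divisible (fireVectors ds (digits m))
  fireVectors-divisible zero [] = _ ∣0
  fireVectors-divisible (suc m) [] = insert-blocks-divisible zero (digits m) (λ _ → refl) (fireVectors-divisible m [])
  fireVectors-divisible (suc m) (d ∷ ds) =
    subst Divisible (sym (fireVectors-digits d ds))
          (insert-blocks-divisible d (fireVectors ds′ (digits m)) (fireVectors-SameSums ds′ (digits-bounded m)) (fireVectors-divisible m ds′))
    where ds′ = punchOutAll d ds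

  I-divisible : ∀ n (w : Permutation′ n) → k′ ^ 2 * k ^ n ∣ 4 * I k n w
  I-divisible n w =
    subst (λ x → k′ ^ 2 * k ^ n ∣ 4 * x) (sym (I≡inversionsBy-lex n w)) (fireVectors-divisible n (map (w ⟨$⟩ʳ_) (allFin n)))

-- 2 ≤ k only excludes k = 0; the argument also covers k = 1.
corollary4p8 : (k n : ℕ) .{{_ : NonZero k}} → 2 ≤ k → (w : Permutation′ n) →
    ((k ∸ 1) ^ 2 * k ^ n) ∣ (4 * I k n w)
corollary4p8 (suc k′) n (s≤s _) w = Radix.I-divisible k′ n w
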